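{- Let \(n\ge 2\) and \(m\ge 2\) be integers. Let \(A_{n,m}=\{w=(w_0,\ldots,w_{n-1})\in(\mathbb Z_m)^n:\sum_{i=0}^{n-1}w_i=0\}\), and put \(q_i=e_i-e_{n-1}\in A_{n,m}\) for \(0\le i\le n-2\) and \(q_{n-1}=0\). Suppose functions \(d_t:A_{n,m}\times\mathbb Z_n\to\mathbb Z_n\), \(t\in\mathbb Z_m\), satisfy: (1) for every \(t\in\mathbb Z_m\) and \(w\in A_{n,m}\), the map \(\kappa\mapsto d_t(w,\kappa)\) is a permutation of \(\mathbb Z_n\); (2) for every \(t\in\mathbb Z_m\) and \(\kappa\in\mathbb Z_n\), the map \(P_{t,\kappa}:A_{n,m}\to A_{n,m}\), \(P_{t,\kappa}(w)=w+q_{d_t(w,\kappa)}\), is a bijection; (3) for every \(\kappa\in\mathbb Z_n\), the composition \(R_\kappa=P_{m-1,\kappa}\circ\cdots\circ P_{1,\kappa}\circ P_{0,\kappa}\) is a single cycle on \(A_{n,m}\) (a cyclic permutation of length \(m^{n-1}\)). Then the directed torus \(D_n(m)=\operatorname{Cay}((\mathbb Z_m)^n,\{e_0,\ldots,e_{n-1}\})\) admits a directed Hamilton decomposition.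
   Context: \(e_0,\ldots,e_{n-1}\) are the standard basis vectors of \((\mathbb Z_m)^n\); the Cayley digraph has vertex set \((\mathbb Z_m)^n\) and arcs \(x\to x+e_i\) for all \(x\) and \(i\). A directed Hamilton decomposition is a partition of the arc set into directed Hamilton cycles. (A family \((d_t)_{t\in\mathbb Z_m}\) satisfying (1)–(3) is called a valid \((n,m)\)-root-flat certificate.) -}

module Defs where

open import Data.Nat using (ℕ; zero; suc; _+_; _^_)
open import Data.Nat.DivMod using (_%_; m%n<n)
open import Data.Nat.Divisibility using (_∣_)
open import Data.Fin using (Fin; toℕ; fromℕ; fromℕ<)
open import Data.Vec using (Vec; updateAt; map; sum)
open import Data.List using (List; foldl; allFin)
open import Data.Product using (Σ; ∃; _×_)
open import Relation.Binary.PropositionalEquality using (_≡_)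

sucMod : {m : ℕ} → Fin m → Fin m
sucMod {suc k} i = fromℕ< (m%n<n (suc (toℕ i)) (suc k))

-- i ↦ i - 1 (mod m)   (i - 1 ≡ i + k  mod  k+1)
predMod : {m : ℕ} → Fin m → Fin m
predMod {suc k} i = fromℕ< (m%n<n (toℕ i + k) (suc k))

Vertex : ℕ → ℕ → Set
Vertex n m = Vec (Fin m) n

addE : {n m : ℕ} → Vertex n m → Fin n → Vertex n m
addE x i = updateAt x i sucMod

subELast : {n m : ℕ} → Vertex n m → Vertex n m
subELast {zero}  x = x
subELast {suc k} x = updateAt x (fromℕ k) predMod

-- w + q_i, where q_i = e_i - e_{n-1}  (so q_{n-1} = 0)
addQ : {n m : ℕ} → Vertex n m → Fin n → Vertex n m
addQ w i = subELast (addE w i)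

InA : (n m : ℕ) → Vertex n m → Set
InA n m w = m ∣ sum (map toℕ w)

P : {n m : ℕ} → (Fin m → Vertex n m → Fin n → Fin n) →
    Fin m → Fin n → Vertex n m → Vertex n m
P d t κ w = addQ w (d t w κ)

-- R_κ = P_{m-1,κ} ∘ ⋯ ∘ P_{1,κ} ∘ P_{0,κ}  (P_{0,κ} applied first)
R : {n m : ℕ} → (Fin m → Vertex n m → Fin n → Fin n) →
    Fin n → Vertex n m → Vertex n m
R {m = m} d κ w = foldl (λ x t → P d t κ x) w (allFin m)

iter : {A : Set} → (A → A) → ℕ → A → A
iter f zero    x = x
iter f (suc k) x = f (iter f k x)

BijectionOnA : (n m : ℕ) → (Vertex n m → Vertex n m) → Set
BijectionOnA n m f =
  (∀ w → InA n m w → InA n m (f w)) ×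
  (∀ w w′ → InA n m w → InA n m w′ → f w ≡ f w′ → w ≡ w′) ×
  (∀ v → InA n m v → Σ (Vertex n m) λ w → InA n m w × f w ≡ v)

SingleCycleOnA : (n m : ℕ) → (Vertex n m → Vertex n m) → Set
SingleCycleOnA n m f =
  ∀ w w′ → InA n m w → InA n m w′ → ∃ λ k → iter f k w ≡ w′

-- Directed Hamilton cycles in D_n(m) = Cay((ℤ_m)^n, {e_0,…,e_{n-1}})
-- Arcs are pairs (x , i) : x → x + e_i.

record HamiltonCycle (n m : ℕ) : Set where
  field
    v    : Fin (m ^ n) → Vertex n m
    lab  : Fin (m ^ n) → Fin n
    v-injective  : ∀ j j′ → v j ≡ v j′ → j ≡ j′
    v-surjective : ∀ x → Σ (Fin (m ^ n)) λ j → v j ≡ x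
    v-arcs       : ∀ j → v (sucMod j) ≡ addE (v j) (lab j)

open HamiltonCycle public

HamiltonDecomposition : (n m : ℕ) → Set
HamiltonDecomposition n m =
  Σ ℕ λ k → Σ (Fin k → HamiltonCycle n m) λ C →
    (∀ (x : Vertex n m) (i : Fin n) →
       Σ (Fin k) λ c → Σ (Fin (m ^ n)) λ j → v (C c) j ≡ x × lab (C c) j ≡ i) ×
    (∀ c j c′ j′ → v (C c) j ≡ v (C c′) j′ → lab (C c) j ≡ lab (C c′) j′ →
       c ≡ c′ × j ≡ j′)

{-# OPTIONS --safe #-}
module Submission where

-- Write ℓ(x) = Σ xᵢ ∈ ℤ_m for the layer of a vertex x and w(x) = x − ℓ(x) e_{n−1} ∈ A_{n,m};
-- x ↦ (ℓ(x), w(x)) is a bijection (ℤ_m)ⁿ ≅ ℤ_m × A_{n,m}. For each colour κ the successor map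
-- x ↦ x + e_{d_{ℓ(x)}(w(x), κ)} raises the layer by one and acts on w(x) by P_{ℓ(x),κ}, so m steps
-- starting in layer 0 act on w as R_κ. The successor map is injective (by (2)), and since R_κ is a
-- single cycle every vertex reaches 0; hence the orbit of 0 is a Hamilton cycle. By (1) the arc
-- x → x + e_i lies on exactly one of these n cycles. Only m, n ≥ 1 and the injectivity in (2) are used.

open import Defs
open import Algebra.Properties.CommutativeSemigroup using (x∙yz≈y∙xz)
open import Data.Empty using (⊥-elim)
import Data.Fin as Fin
open import Data.Fin using (Fin; toℕ; fromℕ; fromℕ<; funToFin; finToFun; combine)
open import Data.Fin.Properties
  using (toℕ-injective; toℕ-fromℕ<; toℕ<n; injective⇒≤; pigeonhole; funToFin-finToFin; finToFun-funToFin)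
  renaming (_≟_ to _≟ᶠ_)
import Data.List as List
open import Data.List using (foldl)
open import Data.Nat using (ℕ; zero; suc; _+_; _*_; _∸_; _≤_; _<_; _^_; NonZero; s≤s; z≤n)
open import Data.Nat.Divisibility using (m%n≡0⇒n∣m)
open import Data.Nat.DivMod
  using (_%_; _/_; _mod_; m≡m%n+[m/n]*n; m%n%n≡m%n; m%n<n; %-distribˡ-+; %-distribˡ-*;
         [m+kn]%n≡m%n; m*n%n≡0; m<n⇒m%n≡m)
open import Data.Nat.Properties
  using (+-commutativeSemigroup; +-assoc; +-comm; +-suc; +-identityʳ; *-identityʳ; *-suc;
         ≤-refl; ≤-trans; ≤-pred; ≤-antisym; ≤-<-trans; <⇒≤; <⇒≱; <-cmp; n<1+n; m∸n≤m; m<n⇒0<n∸m; m+[n∸m]≡n)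
open import Data.Nat.Tactic.RingSolver using (solve-∀)
open import Data.Product using (Σ; ∃; _×_; _,_; proj₁; proj₂)
open import Data.Vec using (_∷_; updateAt; lookup; replicate; tabulate; map; sum)
open import Data.Vec.Properties
  using (updateAt-updateAt; updateAt-cong; updateAt-id; updateAt-commutes;
         lookup∘tabulate; tabulate∘lookup; tabulate-cong)
open import Function using (_∘_; id; _↔_; Inverse; mk↔ₛ′)
open import Function.Definitions using (Injective; Bijective)
open import Relation.Binary using (tri<; tri≈; tri>)
open import Relation.Binary.PropositionalEquality
open import Relation.Nullary using (yes; no)
open ≡-Reasoning

module _ {A : Set} (f : A → A) where

  iter-suc : ∀ j x → iter f (suc j) x ≡ iter f j (f x)
  iter-suc zero    x = refl
  iter-suc (suc j) x = cong f (iter-suc j x)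

  iter-+ : ∀ i j x → iter f (i + j) x ≡ iter f i (iter f j x)
  iter-+ zero    j x = refl
  iter-+ (suc i) j x = cong f (iter-+ i j x)

  iter-injective : Injective _≡_ _≡_ f → ∀ j {x y} → iter f j x ≡ iter f j y → x ≡ y
  iter-injective f-injective zero    eq = eq
  iter-injective f-injective (suc j) eq = iter-injective f-injective j (f-injective eq)

  iter-*-periodic : ∀ {N x} → iter f N x ≡ x → ∀ q → iter f (q * N) x ≡ x
  iter-*-periodic         period zero    = refl
  iter-*-periodic {N} {x} period (suc q) = begin
    iter f (N + q * N) x         ≡⟨ iter-+ N (q * N) x ⟩
    iter f N (iter f (q * N) x)  ≡⟨ cong (iter f N) (iter-*-periodic period q) ⟩
    iter f N x                   ≡⟨ period ⟩
    x                            ∎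

  iter-%-periodic : ∀ {N x} .{{_ : NonZero N}} → iter f N x ≡ x → ∀ a → iter f (a % N) x ≡ iter f a x
  iter-%-periodic {N} {x} period a = begin
    iter f (a % N) x                       ≡⟨ cong (iter f (a % N)) (iter-*-periodic period (a / N)) ⟨
    iter f (a % N) (iter f (a / N * N) x)  ≡⟨ iter-+ (a % N) (a / N * N) x ⟨
    iter f (a % N + a / N * N) x           ≡⟨ cong (λ b → iter f b x) (m≡m%n+[m/n]*n a N) ⟨
    iter f a x                             ∎

  iter-sucMod : ∀ {N x} → iter f N x ≡ x → (j : Fin N) → iter f (toℕ (sucMod j)) x ≡ f (iter f (toℕ j) x)
  iter-sucMod {suc N} {x} period j = begin
    iter f (toℕ (sucMod j)) x       ≡⟨ cong (λ b → iter f b x) (toℕ-fromℕ< (m%n<n (suc (toℕ j)) (suc N))) ⟩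
    iter f (suc (toℕ j) % suc N) x  ≡⟨ iter-%-periodic {suc N} period (suc (toℕ j)) ⟩
    f (iter f (toℕ j) x)            ∎

module Orbit {X : Set} (f : X → X) (f-injective : Injective _≡_ _≡_ f)
             {N : ℕ} (X↔Fin : X ↔ Fin N)
             (x₀ : X) (reaches : ∀ y → ∃ λ j → iter f j y ≡ x₀) where

  open Inverse X↔Fin using (to; from; strictlyInverseˡ; strictlyInverseʳ)

  orbit : ℕ → X
  orbit j = iter f j x₀

  orbit-covers : ∀ {c} → 0 < c → orbit c ≡ x₀ → ∀ y → ∃ λ j → j < c × orbit j ≡ y
  orbit-covers {suc c} _ period y = back (proj₁ (reaches y)) y (proj₂ (reaches y))
    where
    back : ∀ i y → iter f i y ≡ x₀ → ∃ λ j → j < suc c × orbit j ≡ y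
    back zero    y refl = 0 , s≤s z≤n , refl
    back (suc i) y fⁱ⁺¹y≡x₀ with back i (f y) (trans (sym (iter-suc f i y)) fⁱ⁺¹y≡x₀)
    ... | zero  , _    , x₀≡fy = c , ≤-refl , f-injective (trans period x₀≡fy)
    ... | suc j , j<sc , eq    = j , <⇒≤ j<sc , f-injective eq

  period-≥ : ∀ {c} → 0 < c → orbit c ≡ x₀ → N ≤ c
  period-≥ {c} 0<c period = injective⇒≤ {f = position} position-injective
    where
    covering : ∀ y → ∃ λ j → j < c × orbit j ≡ y
    covering = orbit-covers 0<c period
    position : Fin N → Fin c
    position i = fromℕ< (proj₁ (proj₂ (covering (from i))))
    orbit-position : ∀ i → orbit (toℕ (position i)) ≡ from i
    orbit-position i with covering (from i)
    ... | j , j<c , orbit-j = trans (cong orbit (toℕ-fromℕ< j<c)) orbit-j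
    position-injective : Injective _≡_ _≡_ position
    position-injective {i} {i′} eq = begin
      i             ≡⟨ strictlyInverseˡ i ⟨
      to (from i)   ≡⟨ cong to (trans (sym (orbit-position i))
                                   (trans (cong (orbit ∘ toℕ) eq) (orbit-position i′))) ⟩
      to (from i′)  ≡⟨ strictlyInverseˡ i′ ⟩
      i′            ∎

  collision⇒period : ∀ {a b} → a ≤ b → orbit a ≡ orbit b → orbit (b ∸ a) ≡ x₀
  collision⇒period {a} {b} a≤b eq = sym (iter-injective f f-injective a (begin
    iter f a x₀             ≡⟨ eq ⟩
    orbit b                 ≡⟨ cong orbit (m+[n∸m]≡n a≤b) ⟨
    orbit (a + (b ∸ a))     ≡⟨ iter-+ f a (b ∸ a) x₀ ⟩
    iter f a (orbit (b ∸ a)) ∎))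

  collision-free : ∀ {a b} → a < b → b < N → orbit a ≢ orbit b
  collision-free {a} {b} a<b b<N eq =
    <⇒≱ (≤-<-trans (m∸n≤m b a) b<N) (period-≥ (m<n⇒0<n∸m a<b) (collision⇒period (<⇒≤ a<b) eq))

  orbit-injective : ∀ {a b} → a < N → b < N → orbit a ≡ orbit b → a ≡ b
  orbit-injective {a} {b} a<N b<N eq with <-cmp a b
  ... | tri< a<b _ _ = ⊥-elim (collision-free a<b b<N eq)
  ... | tri≈ _ a≡b _ = a≡b
  ... | tri> _ _ b<a = ⊥-elim (collision-free b<a a<N (sym eq))

  -- Pigeonhole gives a period c ≤ N, and period-≥ forces c ≥ N.
  orbit-returns : orbit N ≡ x₀
  orbit-returns with pigeonhole (n<1+n N) (to ∘ orbit ∘ toℕ)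
  ... | i , j , i<j , eq = subst (λ c → orbit c ≡ x₀) c≡N period
    where
    c = toℕ j ∸ toℕ i
    period : orbit c ≡ x₀
    period = collision⇒period (<⇒≤ i<j)
               (trans (sym (strictlyInverseʳ _)) (trans (cong from eq) (strictlyInverseʳ _)))
    c≡N : c ≡ N
    c≡N = ≤-antisym (≤-trans (m∸n≤m (toℕ j) (toℕ i)) (≤-pred (toℕ<n j))) (period-≥ (m<n⇒0<n∸m i<j) period)

  orbit-surjective : ∀ y → ∃ λ j → j < N × orbit j ≡ y
  orbit-surjective = orbit-covers (≤-<-trans z≤n (toℕ<n (to x₀))) orbit-returns

  enumerate : Fin N → X
  enumerate = orbit ∘ toℕ

  enumerate-injective : ∀ i j → enumerate i ≡ enumerate j → i ≡ j
  enumerate-injective i j eq = toℕ-injective (orbit-injective (toℕ<n i) (toℕ<n j) eq)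

  enumerate-surjective : ∀ y → Σ (Fin N) λ j → enumerate j ≡ y
  enumerate-surjective y with orbit-surjective y
  ... | j , j<N , orbit-j = fromℕ< j<N , trans (cong orbit (toℕ-fromℕ< j<N)) orbit-j

  enumerate-sucMod : ∀ j → enumerate (sucMod j) ≡ f (enumerate j)
  enumerate-sucMod = iter-sucMod f orbit-returns

funToFin-cong : ∀ {m n} {f g : Fin m → Fin n} → (∀ i → f i ≡ g i) → funToFin f ≡ funToFin g
funToFin-cong {zero}  f≗g = refl
funToFin-cong {suc m} f≗g = cong₂ combine (f≗g Fin.zero) (funToFin-cong (f≗g ∘ Fin.suc))

Vertex↔Fin : ∀ {n m} → Vertex n m ↔ Fin (m ^ n)
Vertex↔Fin {n} {m} = mk↔ₛ′ (funToFin ∘ lookup) (tabulate ∘ finToFun)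
  (λ i → trans (funToFin-cong {n} {m} (lookup∘tabulate (finToFun i))) (funToFin-finToFin {n} {m} i))
  (λ x → trans (tabulate-cong (finToFun-funToFin (lookup x))) (tabulate∘lookup x))

coordSum : ∀ {n m} → Vertex n m → ℕ
coordSum x = sum (map toℕ x)

coordSum-replicate-zero : ∀ {m} n → coordSum (replicate n (Fin.zero {m})) ≡ 0
coordSum-replicate-zero zero    = refl
coordSum-replicate-zero (suc n) = coordSum-replicate-zero n

module Modulo (k : ℕ) where

  M : ℕ
  M = suc k

  infix 4 _≡ₘ_
  _≡ₘ_ : ℕ → ℕ → Set
  a ≡ₘ b = a % M ≡ b % M

  +-congₘ : ∀ {a b c d} → a ≡ₘ b → c ≡ₘ d → a + c ≡ₘ b + d
  +-congₘ {a} {b} {c} {d} a≡b c≡d = begin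
    (a + c) % M          ≡⟨ %-distribˡ-+ a c M ⟩
    (a % M + c % M) % M  ≡⟨ cong₂ (λ u v → (u + v) % M) a≡b c≡d ⟩
    (b % M + d % M) % M  ≡⟨ %-distribˡ-+ b d M ⟨
    (b + d) % M          ∎

  *-congʳₘ : ∀ {a b} c → a ≡ₘ b → a * c ≡ₘ b * c
  *-congʳₘ {a} {b} c a≡b = begin
    (a * c) % M            ≡⟨ %-distribˡ-* a c M ⟩
    (a % M * (c % M)) % M  ≡⟨ cong (λ u → (u * (c % M)) % M) a≡b ⟩
    (b % M * (c % M)) % M  ≡⟨ %-distribˡ-* b c M ⟨
    (b * c) % M            ∎

  +-cancelˡₘ : ∀ c {a b} → c + a ≡ₘ c + b → a ≡ₘ b
  +-cancelˡₘ c {a} {b} eq = begin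
    a % M                  ≡⟨ [m+kn]%n≡m%n a c M ⟨
    (a + c * M) % M        ≡⟨ cong (_% M) (regroup a) ⟩
    (c * k + (c + a)) % M  ≡⟨ +-congₘ {c * k} {c * k} {c + a} {c + b} refl eq ⟩
    (c * k + (c + b)) % M  ≡⟨ cong (_% M) (regroup b) ⟨
    (b + c * M) % M        ≡⟨ [m+kn]%n≡m%n b c M ⟩
    b % M                  ∎
    where
    regroup′ : ∀ x c k → x + c * suc k ≡ c * k + (c + x)
    regroup′ = solve-∀
    regroup : ∀ x → x + c * M ≡ c * k + (c + x)
    regroup x = regroup′ x c k

  *M+≡ₘ : ∀ r a → r * M + a ≡ₘ a
  *M+≡ₘ r a = trans (cong (_% M) (+-comm (r * M) a)) ([m+kn]%n≡m%n a r M)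

  *k+≡ₘ0 : ∀ a → a * k + a ≡ₘ 0
  *k+≡ₘ0 a = trans (cong (_% M) (trans (+-comm (a * k) a) (sym (*-suc a k)))) (m*n%n≡0 a M)

  toℕ≡ₘ⇒≡ : {i j : Fin M} → toℕ i ≡ₘ toℕ j → i ≡ j
  toℕ≡ₘ⇒≡ {i} {j} eq = toℕ-injective (begin
    toℕ i      ≡⟨ m<n⇒m%n≡m (toℕ<n i) ⟨
    toℕ i % M  ≡⟨ eq ⟩
    toℕ j % M  ≡⟨ m<n⇒m%n≡m (toℕ<n j) ⟩
    toℕ j      ∎)

  record Shifts (c : ℕ) (g : Fin M → Fin M) : Set where
    constructor shifts
    field shift : ∀ a → toℕ (g a) ≡ₘ c + toℕ a

  open Shifts

  shifts-unique : ∀ {c d g h} → Shifts c g → Shifts d h → c ≡ₘ d → ∀ a → g a ≡ h a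
  shifts-unique {c} {d} g+c h+d c≡d a =
    toℕ≡ₘ⇒≡ (trans (shift g+c a) (trans (+-congₘ {c} {d} {toℕ a} c≡d refl) (sym (shift h+d a))))

  shifts-id : Shifts 0 id
  shifts-id = shifts λ a → refl

  shifts-∘ : ∀ {c d g h} → Shifts c g → Shifts d h → Shifts (d + c) (h ∘ g)
  shifts-∘ {c} {d} {g} {h} g+c h+d = shifts λ a → begin
    toℕ (h (g a)) % M      ≡⟨ shift h+d (g a) ⟩
    (d + toℕ (g a)) % M    ≡⟨ +-congₘ {d} {d} {toℕ (g a)} refl (shift g+c a) ⟩
    (d + (c + toℕ a)) % M  ≡⟨ cong (_% M) (+-assoc d c (toℕ a)) ⟨
    (d + c + toℕ a) % M    ∎

  shifts-iter : ∀ {c g} → Shifts c g → ∀ j → Shifts (j * c) (iter g j)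
  shifts-iter g+c zero    = shifts-id
  shifts-iter g+c (suc j) = shifts-∘ (shifts-iter g+c j) g+c

  shifts-sucMod : Shifts 1 sucMod
  shifts-sucMod = shifts λ a → begin
    toℕ (sucMod a) % M    ≡⟨ cong (_% M) (toℕ-fromℕ< (m%n<n (suc (toℕ a)) M)) ⟩
    suc (toℕ a) % M % M   ≡⟨ m%n%n≡m%n (suc (toℕ a)) M ⟩
    suc (toℕ a) % M       ∎

  shifts-predMod : Shifts k predMod
  shifts-predMod = shifts λ a → begin
    toℕ (predMod a) % M    ≡⟨ cong (_% M) (toℕ-fromℕ< (m%n<n (toℕ a + k) M)) ⟩
    (toℕ a + k) % M % M    ≡⟨ m%n%n≡m%n (toℕ a + k) M ⟩
    (toℕ a + k) % M        ≡⟨ cong (_% M) (+-comm (toℕ a) k) ⟩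
    (k + toℕ a) % M        ∎

  coordSum-updateAt : ∀ {n c g} → Shifts c g → (x : Vertex n M) (i : Fin n) →
                      coordSum (updateAt x i g) ≡ₘ c + coordSum x
  coordSum-updateAt {c = c} {g} g+c (a ∷ x) Fin.zero = begin
    (toℕ (g a) + coordSum x) % M    ≡⟨ +-congₘ {toℕ (g a)} {c + toℕ a} {coordSum x} (shift g+c a) refl ⟩
    (c + toℕ a + coordSum x) % M    ≡⟨ cong (_% M) (+-assoc c (toℕ a) (coordSum x)) ⟩
    (c + (toℕ a + coordSum x)) % M  ∎
  coordSum-updateAt {c = c} {g} g+c (a ∷ x) (Fin.suc i) = begin
    (toℕ a + coordSum (updateAt x i g)) % M
      ≡⟨ +-congₘ {toℕ a} {toℕ a} {coordSum (updateAt x i g)} refl (coordSum-updateAt g+c x i) ⟩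
    (toℕ a + (c + coordSum x)) % M
      ≡⟨ cong (_% M) (x∙yz≈y∙xz +-commutativeSemigroup (toℕ a) c (coordSum x)) ⟩
    (c + (toℕ a + coordSum x)) % M
      ∎

module Layers (k n′ : ℕ) where

  open Modulo k public

  n : ℕ
  n = suc n′

  last : Fin n
  last = fromℕ n′

  origin : Vertex n M
  origin = replicate n Fin.zero

  layer : Vertex n M → Fin M
  layer x = coordSum x mod M

  toℕ-layer : ∀ x → toℕ (layer x) ≡ₘ coordSum x
  toℕ-layer x = trans (cong (_% M) (toℕ-fromℕ< (m%n<n (coordSum x) M))) (m%n%n≡m%n (coordSum x) M)

  layer-cong : ∀ {x y} → coordSum x ≡ₘ coordSum y → layer x ≡ layer y
  layer-cong {x} {y} eq = toℕ≡ₘ⇒≡ (trans (toℕ-layer x) (trans eq (sym (toℕ-layer y))))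

  -- The paper's w(x) = x − ℓ(x) e_{n−1}.
  toA : Vertex n M → Vertex n M
  toA x = updateAt x last (iter predMod (coordSum x))

  coordSum-addE : (x : Vertex n M) (i : Fin n) → coordSum (addE x i) ≡ₘ 1 + coordSum x
  coordSum-addE = coordSum-updateAt shifts-sucMod

  toA-InA : ∀ x → InA n M (toA x)
  toA-InA x = m%n≡0⇒n∣m (coordSum (toA x)) M (begin
    coordSum (toA x) % M            ≡⟨ coordSum-updateAt (shifts-iter shifts-predMod s) x last ⟩
    (s * k + s) % M                 ≡⟨ *k+≡ₘ0 s ⟩
    0                               ∎)
    where
    s = coordSum x

  lift-toA : ∀ x → updateAt (toA x) last (iter sucMod (coordSum x)) ≡ x
  lift-toA x = begin
    updateAt (toA x) last (iter sucMod s)             ≡⟨ updateAt-updateAt last x ⟩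
    updateAt x last (iter sucMod s ∘ iter predMod s)  ≡⟨ updateAt-cong last cancels x ⟩
    updateAt x last id                                ≡⟨ updateAt-id last x ⟩
    x                                                 ∎
    where
    s = coordSum x
    s*M≡ₘ0 : s * 1 + s * k ≡ₘ 0
    s*M≡ₘ0 = trans (cong (_% M) (trans (cong (_+ s * k) (*-identityʳ s)) (+-comm s (s * k)))) (*k+≡ₘ0 s)
    cancels : ∀ a → iter sucMod s (iter predMod s a) ≡ a
    cancels = shifts-unique (shifts-∘ (shifts-iter shifts-predMod s) (shifts-iter shifts-sucMod s))
                            shifts-id s*M≡ₘ0

  coordSum-toA-injective : ∀ {x y} → coordSum x ≡ₘ coordSum y → toA x ≡ toA y → x ≡ y
  coordSum-toA-injective {x} {y} sx≡sy toAx≡toAy = begin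
    x                                   ≡⟨ lift-toA x ⟨
    updateAt (toA x) last (iter sucMod sx) ≡⟨ cong (λ w → updateAt w last (iter sucMod sx)) toAx≡toAy ⟩
    updateAt (toA y) last (iter sucMod sx) ≡⟨ updateAt-cong last same-shift (toA y) ⟩
    updateAt (toA y) last (iter sucMod sy) ≡⟨ lift-toA y ⟩
    y                                   ∎
    where
    sx = coordSum x
    sy = coordSum y
    same-shift : ∀ a → iter sucMod sx a ≡ iter sucMod sy a
    same-shift = shifts-unique (shifts-iter shifts-sucMod sx) (shifts-iter shifts-sucMod sy)
                               (*-congʳₘ {sx} {sy} 1 sx≡sy)

  iter-predMod-sucMod : ∀ j a → iter predMod j (sucMod a) ≡ sucMod (iter predMod j a)
  iter-predMod-sucMod j = shifts-unique (shifts-∘ shifts-sucMod (shifts-iter shifts-predMod j))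
                                        (shifts-∘ (shifts-iter shifts-predMod j) shifts-sucMod)
                                        (cong (_% M) (+-comm (j * k) 1))

  iter-predMod-addE : ∀ x i a → iter predMod (coordSum (addE x i)) a ≡ predMod (iter predMod (coordSum x) a)
  iter-predMod-addE x i =
    shifts-unique (shifts-iter shifts-predMod (coordSum (addE x i)))
                  (shifts-∘ (shifts-iter shifts-predMod (coordSum x)) shifts-predMod)
                  (*-congʳₘ {coordSum (addE x i)} {1 + coordSum x} k (coordSum-addE x i))

  toA-addE-last : ∀ x → toA (addE x last) ≡ addQ (toA x) last
  toA-addE-last x = begin
    updateAt (addE x last) last (iter predMod (coordSum (addE x last)))
      ≡⟨ updateAt-updateAt last x ⟩
    updateAt x last (iter predMod (coordSum (addE x last)) ∘ sucMod)
      ≡⟨ updateAt-cong last (λ a → trans (iter-predMod-addE x last (sucMod a))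
                                         (cong predMod (iter-predMod-sucMod s a))) x ⟩
    updateAt x last (predMod ∘ sucMod ∘ iter predMod s)
      ≡⟨ updateAt-updateAt last x ⟨
    updateAt (updateAt x last (sucMod ∘ iter predMod s)) last predMod
      ≡⟨ cong (λ y → updateAt y last predMod) (updateAt-updateAt last x) ⟨
    addQ (toA x) last
      ∎
    where
    s = coordSum x

  toA-addE-other : ∀ x i → i ≢ last → toA (addE x i) ≡ addQ (toA x) i
  toA-addE-other x i i≢last = begin
    updateAt (addE x i) last (iter predMod (coordSum (addE x i)))
      ≡⟨ updateAt-cong last (iter-predMod-addE x i) (addE x i) ⟩
    updateAt (addE x i) last (predMod ∘ iter predMod s)
      ≡⟨ updateAt-updateAt last (addE x i) ⟨
    updateAt (updateAt (addE x i) last (iter predMod s)) last predMod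
      ≡⟨ cong (λ y → updateAt y last predMod) (updateAt-commutes last i (i≢last ∘ sym) x) ⟩
    addQ (toA x) i
      ∎
    where
    s = coordSum x

  toA-addE : ∀ x i → toA (addE x i) ≡ addQ (toA x) i
  toA-addE x i with i ≟ᶠ last
  ... | yes refl   = toA-addE-last x
  ... | no i≢last  = toA-addE-other x i i≢last

module Successor (k n′ : ℕ) (d : Fin (suc k) → Vertex (suc n′) (suc k) → Fin (suc n′) → Fin (suc n′)) where

  open Layers k n′

  dir : Fin n → Vertex n M → Fin n
  dir κ x = d (layer x) (toA x) κ

  next : Fin n → Vertex n M → Vertex n M
  next κ x = addE x (dir κ x)

  toA-next : ∀ κ x → toA (next κ x) ≡ P d (layer x) κ (toA x)
  toA-next κ x = toA-addE x (dir κ x)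

  coordSum-iter-next : ∀ κ j x → coordSum (iter (next κ) j x) ≡ₘ j + coordSum x
  coordSum-iter-next κ zero    x = refl
  coordSum-iter-next κ (suc j) x =
    trans (coordSum-addE y (dir κ y)) (+-congₘ {1} {1} {coordSum y} refl (coordSum-iter-next κ j x))
    where
    y = iter (next κ) j x

  next-injective : (∀ t κ w w′ → InA n M w → InA n M w′ → P d t κ w ≡ P d t κ w′ → w ≡ w′) →
                   ∀ κ → Injective _≡_ _≡_ (next κ)
  next-injective P-injective κ {x} {y} eq =
    coordSum-toA-injective {x} {y} sums
      (P-injective (layer x) κ (toA x) (toA y) (toA-InA x) (toA-InA y) P-eq)
    where
    sums : coordSum x ≡ₘ coordSum y
    sums = +-cancelˡₘ 1 (trans (sym (coordSum-addE x (dir κ x)))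
                               (trans (cong (λ z → coordSum z % M) eq) (coordSum-addE y (dir κ y))))
    P-eq : P d (layer x) κ (toA x) ≡ P d (layer x) κ (toA y)
    P-eq = begin
      P d (layer x) κ (toA x)  ≡⟨ toA-next κ x ⟨
      toA (next κ x)           ≡⟨ cong toA eq ⟩
      toA (next κ y)           ≡⟨ toA-next κ y ⟩
      P d (layer y) κ (toA y)  ≡⟨ cong (λ t → P d t κ (toA y)) (layer-cong {x} {y} sums) ⟨
      P d (layer x) κ (toA y)  ∎

  -- g i is the layer of the i-th iterate, so the iterates apply P_{g 0, κ}, P_{g 1, κ}, … in turn.
  toA-iter-next : ∀ κ {L} (g : Fin L → Fin M) x → (∀ i → toℕ (g i) ≡ₘ coordSum x + toℕ i) →
                  toA (iter (next κ) L x) ≡ foldl (λ w t → P d t κ w) (toA x) (List.tabulate g)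
  toA-iter-next κ {zero}  g x g-layers = refl
  toA-iter-next κ {suc L} g x g-layers = begin
    toA (iter (next κ) (suc L) x)      ≡⟨ cong toA (iter-suc (next κ) L x) ⟩
    toA (iter (next κ) L (next κ x))   ≡⟨ toA-iter-next κ (g ∘ Fin.suc) (next κ x) g-layers′ ⟩
    foldl step (toA (next κ x)) rest   ≡⟨ cong (λ w → foldl step w rest) (toA-next κ x) ⟩
    foldl step (P d (layer x) κ (toA x)) rest
                                       ≡⟨ cong (λ t → foldl step (P d t κ (toA x)) rest) layer≡ ⟩
    foldl step (P d (g Fin.zero) κ (toA x)) rest ∎
    where
    step = λ w t → P d t κ w
    rest = List.tabulate (g ∘ Fin.suc)
    layer≡ : layer x ≡ g Fin.zero
    layer≡ = toℕ≡ₘ⇒≡ (trans (toℕ-layer x)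
                             (sym (trans (g-layers Fin.zero) (cong (_% M) (+-identityʳ (coordSum x))))))
    g-layers′ : ∀ i → toℕ (g (Fin.suc i)) ≡ₘ coordSum (next κ x) + toℕ i
    g-layers′ i = begin
      toℕ (g (Fin.suc i)) % M          ≡⟨ g-layers (Fin.suc i) ⟩
      (coordSum x + suc (toℕ i)) % M   ≡⟨ cong (_% M) (+-suc (coordSum x) (toℕ i)) ⟩
      (1 + coordSum x + toℕ i) % M     ≡⟨ +-congₘ {coordSum (next κ x)} {1 + coordSum x} {toℕ i}
                                                   (coordSum-addE x (dir κ x)) refl ⟨
      (coordSum (next κ x) + toℕ i) % M ∎

  toA-round : ∀ κ x → coordSum x ≡ₘ 0 → toA (iter (next κ) M x) ≡ R d κ (toA x)
  toA-round κ x x≡0 = toA-iter-next κ id x (λ i → sym (+-congₘ {coordSum x} {0} {toℕ i} {toℕ i} x≡0 refl))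

  toA-rounds : ∀ κ x → coordSum x ≡ₘ 0 → ∀ r → toA (iter (next κ) (r * M) x) ≡ iter (R d κ) r (toA x)
  toA-rounds κ x x≡0 zero    = refl
  toA-rounds κ x x≡0 (suc r) = begin
    toA (iter (next κ) (M + r * M) x)  ≡⟨ cong toA (iter-+ (next κ) M (r * M) x) ⟩
    toA (iter (next κ) M y)            ≡⟨ toA-round κ y y≡0 ⟩
    R d κ (toA y)                      ≡⟨ cong (R d κ) (toA-rounds κ x x≡0 r) ⟩
    R d κ (iter (R d κ) r (toA x))     ∎
    where
    y = iter (next κ) (r * M) x
    y≡0 : coordSum y ≡ₘ 0
    y≡0 = trans (coordSum-iter-next κ (r * M) x) (trans (*M+≡ₘ r (coordSum x)) x≡0)

  reaches-origin : ∀ κ → SingleCycleOnA n M (R d κ) → ∀ y → ∃ λ j → iter (next κ) j y ≡ origin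
  -- As k ≡ −1 (mod M), j₀ steps take y to layer 0; from there each round of M steps acts by R_κ.
  reaches-origin κ R-cyclic y = r * M + j₀ , (begin
    iter (next κ) (r * M + j₀) y  ≡⟨ iter-+ (next κ) (r * M) j₀ y ⟩
    iter (next κ) (r * M) y₀      ≡⟨ coordSum-toA-injective {iter (next κ) (r * M) y₀} {origin}
                                                            sums toA-returns ⟩
    origin                        ∎)
    where
    j₀ = coordSum y * k
    y₀ = iter (next κ) j₀ y
    y₀≡0 : coordSum y₀ ≡ₘ 0
    y₀≡0 = trans (coordSum-iter-next κ j₀ y) (*k+≡ₘ0 (coordSum y))
    R-path = R-cyclic (toA y₀) (toA origin) (toA-InA y₀) (toA-InA origin)
    r = proj₁ R-path
    toA-returns : toA (iter (next κ) (r * M) y₀) ≡ toA origin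
    toA-returns = trans (toA-rounds κ y₀ y₀≡0 r) (proj₂ R-path)
    sums : coordSum (iter (next κ) (r * M) y₀) ≡ₘ coordSum origin
    sums = trans (coordSum-iter-next κ (r * M) y₀)
                 (trans (*M+≡ₘ r (coordSum y₀)) (trans y₀≡0 (cong (_% M) (sym (coordSum-replicate-zero n)))))

  module _ (P-injective : ∀ t κ w w′ → InA n M w → InA n M w′ → P d t κ w ≡ P d t κ w′ → w ≡ w′)
           (R-cyclic : ∀ κ → SingleCycleOnA n M (R d κ)) where

    hamiltonCycle : Fin n → HamiltonCycle n M
    hamiltonCycle κ = record
      { v            = enumerate
      ; lab          = dir κ ∘ enumerate
      ; v-injective  = enumerate-injective
      ; v-surjective = enumerate-surjective
      ; v-arcs       = enumerate-sucMod
      }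
      where
      open Orbit (next κ) (next-injective P-injective κ) Vertex↔Fin origin (reaches-origin κ (R-cyclic κ))

    hamiltonDecomposition : (∀ t w → InA n M w → Bijective _≡_ _≡_ (d t w)) → HamiltonDecomposition n M
    hamiltonDecomposition d-bijective = n , hamiltonCycle , covered , disjoint
      where
      d-bijective-at : ∀ x → Bijective _≡_ _≡_ (d (layer x) (toA x))
      d-bijective-at x = d-bijective (layer x) (toA x) (toA-InA x)

      covered : ∀ x i → Σ (Fin n) λ κ → Σ (Fin (M ^ n)) λ j →
                v (hamiltonCycle κ) j ≡ x × lab (hamiltonCycle κ) j ≡ i
      covered x i = κ , j , vj≡x , trans (cong (dir κ) vj≡x) (proj₂ dir-onto refl)
        where
        dir-onto = proj₂ (d-bijective-at x) i
        κ = proj₁ dir-onto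
        j = proj₁ (v-surjective (hamiltonCycle κ) x)
        vj≡x = proj₂ (v-surjective (hamiltonCycle κ) x)

      same-cycle : ∀ {c c′} j j′ → c ≡ c′ → v (hamiltonCycle c) j ≡ v (hamiltonCycle c′) j′ →
                   c ≡ c′ × j ≡ j′
      same-cycle {c} j j′ refl v≡ = refl , v-injective (hamiltonCycle c) j j′ v≡

      disjoint : ∀ c j c′ j′ → v (hamiltonCycle c) j ≡ v (hamiltonCycle c′) j′ →
                 lab (hamiltonCycle c) j ≡ lab (hamiltonCycle c′) j′ → c ≡ c′ × j ≡ j′
      disjoint c j c′ j′ v≡ lab≡ = same-cycle j j′ c≡c′ v≡
        where
        c≡c′ = proj₁ (d-bijective-at (v (hamiltonCycle c) j)) (trans lab≡ (cong (dir c′) (sym v≡)))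

theorem2p2 : (n m : ℕ) → 2 ≤ n → 2 ≤ m →
    (d : Fin m → Vertex n m → Fin n → Fin n) →
    (∀ t w → InA n m w → Bijective _≡_ _≡_ (λ κ → d t w κ)) →
    (∀ t κ → BijectionOnA n m (P d t κ)) →
    (∀ κ → SingleCycleOnA n m (R d κ)) →
    HamiltonDecomposition n m
theorem2p2 (suc n′) (suc k) (s≤s _) (s≤s _) d d-bijective P-bijective R-cyclic =
  hamiltonDecomposition (λ t κ → proj₁ (proj₂ (P-bijective t κ))) R-cyclic d-bijective
  where
  open Successor k n′ d
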